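{- Let $\kappa\in(0,1)$, $\delta,\eta>0$ with $\kappa+\delta\le\frac12$. For all sufficiently large $n$ (with $n^{1/3}$ an integer) the following holds. Let $G_\kappa$ be a $\kappa$-template-graph on $[n]$ with an orientation $\vec G_\kappa$, let $W_1,\dots,W_m,R$ be an $\eta$-weak tiling of $\vec G_\kappa$ with free matrix $M$, and let $M'=M[\mathcal W,V]$ be a $\delta$-good sub-matrix with $|V|=2n^{2/3}$. Let $V=V_1\uplus V_2$ and $\mathcal W=\mathcal W_1\uplus\mathcal W_2$ be partitions such that $|V_1|=|V_2|=n^{2/3}$, $|\mathcal W_1|\geq(\frac12-\delta-\kappa)n^{1/3}-2$, $|\mathcal W_2|<(\frac12+\delta+\kappa)n^{1/3}$, every row of $M'[\mathcal W_1,V_1]$ has weight at most $\kappa n^{2/3}$, and every row of $M'[\mathcal W_2,V_1]$ has weight at least $\kappa n^{2/3}$. Then every row of $M'[\mathcal W_1,V_2]$ has weight at least $(1-2\delta-2\kappa)n^{2/3}$.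
   Context: A $\kappa$-template-graph is an undirected graph on $[n]$ such that any two disjoint vertex sets of size at least $\kappa n^{2/3}$ are joined by an edge. For $X\subseteq[n]$, $d^+(X)$ is the number of arcs of $\vec G_\kappa$ from $X$ to $[n]\setminus X$; $X$ is $\eta$-weak if $d^+(X)<(1/2+\eta)n$. An $\eta$-weak tiling is a partition $W_1,\dots,W_m,R$ of $[n]$ with $|W_i|=n^{2/3}$, $|R|<2n^{2/3}$, each $W_i$ $\eta$-weak; $\mathcal W=\{W_1,\dots,W_m\}$. $F(W)=[n]\setminus(N^+(W)\cup W)$ with $N^+(W)$ the union of out-neighbourhoods in $\vec G_\kappa$. The free matrix $M$ has rows indexed by $\mathcal W$, columns by $[n]$, entry $1$ at $(W_i,v)$ iff $v\in F(W_i)$. $M[\mathcal W',U]$ is the sub-matrix on rows $\mathcal W'$ and columns $U$; weight = number of $1$'s. $M[\mathcal W,U]$ is $\delta$-good if each row has weight at least $(\frac12-\delta-2n^{ -1/3}(\log n)^{1/2})|U|$ ($\log$ natural).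
   Formalization: The parameters κ, δ and η range over the rationals. -}

module Defs where

open import Data.Nat as ℕ using (ℕ; zero; suc)
open import Data.Fin using (Fin; zero; suc)
open import Data.Bool using (Bool; true; false; T; not; _∧_; _∨_; if_then_else_)
open import Data.Integer as ℤ using (ℤ)
open import Data.Rational as ℚ using (ℚ; _/_; _+_; _*_; _-_; _≤_; _<_; 0ℚ; 1ℚ)
open import Data.Product using (Σ; ∃; _×_; _,_)
open import Data.Sum using (_⊎_)
open import Relation.Nullary using (¬_)
open import Relation.Binary.PropositionalEquality using (_≡_)

⟦_⟧ : ℕ → ℚ
⟦ k ⟧ = ℤ.+ k / 1

½ : ℚ
½ = ℤ.+ 1 / 2

sumF : {n : ℕ} → (Fin n → ℕ) → ℕ
sumF {zero} f = 0
sumF {suc n} f = f zero ℕ.+ sumF (λ i → f (suc i))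

anyF : {n : ℕ} → (Fin n → Bool) → Bool
anyF {zero} f = false
anyF {suc n} f = f zero ∨ anyF (λ i → f (suc i))

Set' : ℕ → Set
Set' n = Fin n → Bool

_∈_ : {n : ℕ} → Fin n → Set' n → Set
v ∈ X = T (X v)

_∉_ : {n : ℕ} → Fin n → Set' n → Set
v ∉ X = ¬ (v ∈ X)

b2n : Bool → ℕ
b2n true = 1
b2n false = 0

∣_∣ : {n : ℕ} → Set' n → ℕ
∣ X ∣ = sumF (λ v → b2n (X v))

_∩_ : {n : ℕ} → Set' n → Set' n → Set' n
(X ∩ Y) v = X v ∧ Y v

Disjoint : {n : ℕ} → Set' n → Set' n → Set
Disjoint X Y = ∀ v → v ∈ X → v ∉ Y

Partition₂ : {n : ℕ} → Set' n → Set' n → Set' n → Set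
Partition₂ Z X Y = Disjoint X Y × (∀ v → v ∈ Z → (v ∈ X ⊎ v ∈ Y))
                   × (∀ v → v ∈ X → v ∈ Z) × (∀ v → v ∈ Y → v ∈ Z)

record Graph (n : ℕ) : Set where
  field
    adj   : Fin n → Fin n → Bool
    sym   : ∀ u v → T (adj u v) → T (adj v u)
    irrefl : ∀ v → ¬ T (adj v v)

-- κ-template-graph: any two disjoint sets of size ≥ κ n^{2/3} (= κ t², n = t³)
-- are joined by an edge
IsTemplate : (κ : ℚ) (t : ℕ) → Graph (t ℕ.^ 3) → Set
IsTemplate κ t G = ∀ (X Y : Set' (t ℕ.^ 3)) → Disjoint X Y →
  κ * ⟦ t ℕ.^ 2 ⟧ ≤ ⟦ ∣ X ∣ ⟧ → κ * ⟦ t ℕ.^ 2 ⟧ ≤ ⟦ ∣ Y ∣ ⟧ →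
  ∃ λ x → ∃ λ y → x ∈ X × y ∈ Y × T (Graph.adj G x y)

IsOrientation : {n : ℕ} → Graph n → (Fin n → Fin n → Bool) → Set
IsOrientation G A =
  (∀ u v → T (A u v) → T (Graph.adj G u v)) ×
  (∀ u v → T (Graph.adj G u v) → T (A u v) ⊎ T (A v u)) ×
  (∀ u v → T (A u v) → ¬ T (A v u))

dplus : {n : ℕ} → (Fin n → Fin n → Bool) → Set' n → ℕ
dplus A X = sumF (λ u → sumF (λ v → b2n (X u ∧ not (X v) ∧ A u v)))

IsWeak : (η : ℚ) {n : ℕ} → (Fin n → Fin n → Bool) → Set' n → Set
IsWeak η {n} A X = ⟦ dplus A X ⟧ < (½ + η) * ⟦ n ⟧

IsWeakTiling : (η : ℚ) (t : ℕ) (A : Fin (t ℕ.^ 3) → Fin (t ℕ.^ 3) → Bool)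
  (m : ℕ) (W : Fin m → Set' (t ℕ.^ 3)) (R : Set' (t ℕ.^ 3)) → Set
IsWeakTiling η t A m W R =
  (∀ i j → ¬ (i ≡ j) → Disjoint (W i) (W j)) ×
  (∀ i → Disjoint (W i) R) ×
  (∀ v → (∃ λ i → v ∈ W i) ⊎ v ∈ R) ×
  (∀ i → ∣ W i ∣ ≡ t ℕ.^ 2) ×
  (∣ R ∣ ℕ.< 2 ℕ.* t ℕ.^ 2) ×
  (∀ i → IsWeak η A (W i))

Free : {n : ℕ} → (Fin n → Fin n → Bool) → Set' n → Set' n
Free A W v = not (W v) ∧ not (anyF (λ u → W u ∧ A u v))

freeMatrix : {n m : ℕ} → (Fin n → Fin n → Bool) → (Fin m → Set' n) → Fin m → Fin n → Bool
freeMatrix A W i v = Free A (W i) v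

rowWeight : {n m : ℕ} → (Fin m → Fin n → Bool) → Fin m → Set' n → ℕ
rowWeight M i U = ∣ (λ v → U v ∧ M i v) ∣

expTerm : ℚ → ℕ → ℚ
expTerm q zero = 1ℚ
expTerm q (suc j) = expTerm q j * q * (ℤ.+ 1 / suc j)

expPartial : ℚ → ℕ → ℚ
expPartial q zero = expTerm q 0
expPartial q (suc k) = expPartial q k + expTerm q (suc k)

-- exp(q) ≤ N, for q ≥ 0 (exp q is the supremum of its partial sums)
ExpLe : ℚ → ℕ → Set
ExpLe q N = ∀ k → expPartial q k ≤ ⟦ N ⟧

-- The real inequality  w ≥ (1/2 − δ − 2 n^{-1/3} (log n)^{1/2}) u,  with n = t³, t ≥ 1.
-- Put c = (1/2 − δ) u − w. It is equivalent to  c ≤ 0,  or  (c t)² ≤ 4 u² log n,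
-- i.e.  exp((c t)²) ≤ n^{4u²}.
GoodBound : (δ : ℚ) (t w u : ℕ) → Set
GoodBound δ t w u =
  let c = (½ - δ) * ⟦ u ⟧ - ⟦ w ⟧ in
  (c ≤ 0ℚ) ⊎ ExpLe ((c * ⟦ t ⟧) * (c * ⟦ t ⟧)) ((t ℕ.^ 3) ℕ.^ (4 ℕ.* (u ℕ.* u)))

IsGood : (δ : ℚ) (t : ℕ) {m : ℕ} → (Fin m → Fin (t ℕ.^ 3) → Bool) → Set' (t ℕ.^ 3) → Set
IsGood δ t M U = ∀ i → GoodBound δ t (rowWeight M i U) ∣ U ∣

-- A δ-good row of M[𝒲, V] has weight at least (1/2 − δ − 2 n^{-1/3} (log n)^{1/2}) |V|.
-- With |V| = 2t² (n = t³) the error term is 4t (log n)^{1/2}, which is below κ t² once t is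
-- large; so every row has weight at least (1 − 2δ − κ) t² on V.  A row of 𝒲₁ spends at most
-- κ t² of it on V₁, leaving (1 − 2δ − 2κ) t² on V₂.  In the encoding GoodBound, with c = (1/2 − δ)|V| − w, the error estimate
-- reads exp((c t)²) ≤ t^K for K = 48 t⁴; it forces c ≤ κ t², since otherwise q = (c t)²
-- is at least (1 + t) K and the single term q^K/K! of the exponential series exceeds t^K.
module Submission where

open import Defs
open import Data.Nat as ℕ using (ℕ; zero; suc)
import Data.Nat.Properties as ℕP
open import Data.Nat.Coprimality as Coprime using (Coprime)
open import Data.Nat.Tactic.RingSolver using (solve-∀)
open import Data.Fin using (Fin; zero; suc)
open import Data.Bool using (Bool; true; false; T; _∧_)
open import Data.Integer as ℤ using (+_)
import Data.Integer.Properties as ℤP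
open import Data.Rational as ℚ using (ℚ; mkℚ; _/_; _+_; _*_; _-_; _≤_; _<_; 0ℚ; 1ℚ)
open import Data.Rational.Properties
open import Data.Rational.Solver using (module +-*-Solver)
open import Data.Empty using (⊥-elim)
open import Data.Product using (∃; _,_)
open import Data.Sum using (_⊎_; inj₁; inj₂)
open import Relation.Nullary using (¬_; yes; no)
open import Relation.Binary.PropositionalEquality

coprime-1 : ∀ k → Coprime k 1
coprime-1 k = Coprime.sym (Coprime.1-coprimeTo k)

⟦⟧≡mkℚ : ∀ k → ⟦ k ⟧ ≡ mkℚ (+ k) 0 (Coprime.recompute (coprime-1 k))
⟦⟧≡mkℚ k = normalize-coprime (coprime-1 k)

⟦⟧-homo-+ : ∀ a b → ⟦ a ℕ.+ b ⟧ ≡ ⟦ a ⟧ + ⟦ b ⟧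
⟦⟧-homo-+ a b rewrite ⟦⟧≡mkℚ a | ⟦⟧≡mkℚ b =
  cong (_/ 1) (sym (cong₂ ℤ._+_ (ℤP.*-identityʳ (+ a)) (ℤP.*-identityʳ (+ b))))

⟦⟧-homo-* : ∀ a b → ⟦ a ℕ.* b ⟧ ≡ ⟦ a ⟧ * ⟦ b ⟧
⟦⟧-homo-* a b rewrite ⟦⟧≡mkℚ a | ⟦⟧≡mkℚ b = cong (_/ 1) (ℤP.pos-* a b)

⟦⟧-mono-≤ : ∀ {a b} → a ℕ.≤ b → ⟦ a ⟧ ≤ ⟦ b ⟧
⟦⟧-mono-≤ {a} {b} a≤b rewrite ⟦⟧≡mkℚ a | ⟦⟧≡mkℚ b =
  ℚ.*≤* (subst₂ ℤ._≤_ (sym (ℤP.*-identityʳ (+ a))) (sym (ℤP.*-identityʳ (+ b))) (ℤ.+≤+ a≤b))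

⟦⟧-cancel-≤ : ∀ {a b} → ⟦ a ⟧ ≤ ⟦ b ⟧ → a ℕ.≤ b
⟦⟧-cancel-≤ {a} {b} ⟦a⟧≤⟦b⟧ rewrite ⟦⟧≡mkℚ a | ⟦⟧≡mkℚ b =
  ℤP.drop‿+≤+ (subst₂ ℤ._≤_ (ℤP.*-identityʳ (+ a)) (ℤP.*-identityʳ (+ b)) (drop-*≤* ⟦a⟧≤⟦b⟧))

0≤⟦⟧ : ∀ k → 0ℚ ≤ ⟦ k ⟧
0≤⟦⟧ k = ⟦⟧-mono-≤ {0} {k} ℕ.z≤n

0≤* : ∀ {p q} → 0ℚ ≤ p → 0ℚ ≤ q → 0ℚ ≤ p * q
0≤* {p} {q} 0≤p 0≤q =
  nonNegative⁻¹ (p * q) {{nonNeg*nonNeg⇒nonNeg p {{ℚ.nonNegative 0≤p}} q {{ℚ.nonNegative 0≤q}}}}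

*-mono-≤-nonNeg : ∀ {p q r s} → 0ℚ ≤ p → 0ℚ ≤ r → p ≤ q → r ≤ s → p * r ≤ q * s
*-mono-≤-nonNeg {q = q} {r} 0≤p 0≤r p≤q r≤s =
  ≤-trans (*-monoʳ-≤-nonNeg r {{ℚ.nonNegative 0≤r}} p≤q)
          (*-monoˡ-≤-nonNeg q {{ℚ.nonNegative (≤-trans 0≤p p≤q)}} r≤s)

p≤q⇒p-q≤0 : ∀ {p q} → p ≤ q → p - q ≤ 0ℚ
p≤q⇒p-q≤0 {p} {q} p≤q = subst (p - q ≤_) (+-inverseʳ q) (+-monoˡ-≤ (ℚ.- q) p≤q)

1/[1+_] : ℕ → ℚ
1/[1+ d ] = + 1 / suc d

0≤1/[1+_] : ∀ d → 0ℚ ≤ 1/[1+ d ]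
0≤1/[1+ d ] = nonNegative⁻¹ 1/[1+ d ] {{normalize-nonNeg 1 (suc d)}}

⟦1+⟧*1/[1+]≡1 : ∀ d → ⟦ suc d ⟧ * 1/[1+ d ] ≡ 1ℚ
⟦1+⟧*1/[1+]≡1 d rewrite ⟦⟧≡mkℚ (suc d) | normalize-coprime (Coprime.1-coprimeTo (suc d)) =
  *-inverseʳ (mkℚ (+ suc d) 0 (Coprime.recompute (coprime-1 (suc d))))

∃1/[1+]≤ : ∀ {κ} → 0ℚ < κ → ∃ λ d → 1/[1+ d ] ≤ κ
∃1/[1+]≤ {κ@(mkℚ (+ suc n) d _)} _ = d , subst (_≤ κ) (sym (normalize-coprime (Coprime.1-coprimeTo (suc d))))
  (ℚ.*≤* (subst₂ ℤ._≤_ (ℤP.pos-* 1 (suc d)) (ℤP.pos-* (suc n) (suc d))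
    (ℤ.+≤+ (ℕP.*-monoˡ-≤ (suc d) (ℕ.s≤s (ℕ.z≤n {n}))))))
∃1/[1+]≤ {mkℚ (+ 0) _ _} 0<κ with () ← ℚ.positive 0<κ
∃1/[1+]≤ {mkℚ ℤ.-[1+ _ ] _ _} 0<κ with () ← ℚ.positive 0<κ

⟦⟧≤square-div : ∀ a b d → a ℕ.* (suc d ℕ.* suc d) ℕ.≤ b ℕ.* b →
  ⟦ a ⟧ ≤ (1/[1+ d ] * ⟦ b ⟧) * (1/[1+ d ] * ⟦ b ⟧)
⟦⟧≤square-div a b d aD²≤b² = begin
  ⟦ a ⟧                                   ≡⟨ sym (*-identityʳ ⟦ a ⟧) ⟩
  ⟦ a ⟧ * (1ℚ * 1ℚ)                       ≡⟨ cong (λ x → ⟦ a ⟧ * (x * x)) (sym (⟦1+⟧*1/[1+]≡1 d)) ⟩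
  ⟦ a ⟧ * ((⟦ D ⟧ * r) * (⟦ D ⟧ * r))     ≡⟨ regroup ⟦ a ⟧ ⟦ D ⟧ r ⟩
  (r * r) * (⟦ a ⟧ * (⟦ D ⟧ * ⟦ D ⟧))     ≡⟨ cong (λ x → (r * r) * x) (sym ⟦aD²⟧) ⟩
  (r * r) * ⟦ a ℕ.* (D ℕ.* D) ⟧           ≤⟨ *-monoˡ-≤-nonNeg (r * r) {{ℚ.nonNegative 0≤r²}} (⟦⟧-mono-≤ aD²≤b²) ⟩
  (r * r) * ⟦ b ℕ.* b ⟧                   ≡⟨ cong (λ x → (r * r) * x) (⟦⟧-homo-* b b) ⟩
  (r * r) * (⟦ b ⟧ * ⟦ b ⟧)               ≡⟨ regroup′ r ⟦ b ⟧ ⟩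
  (r * ⟦ b ⟧) * (r * ⟦ b ⟧)               ∎
  where
  open ≤-Reasoning
  open +-*-Solver using (solve; _:=_; _:*_)
  D : ℕ
  D = suc d
  r : ℚ
  r = 1/[1+ d ]
  0≤r² : 0ℚ ≤ r * r
  0≤r² = 0≤* (0≤1/[1+ d ]) (0≤1/[1+ d ])
  ⟦aD²⟧ : ⟦ a ℕ.* (D ℕ.* D) ⟧ ≡ ⟦ a ⟧ * (⟦ D ⟧ * ⟦ D ⟧)
  ⟦aD²⟧ = trans (⟦⟧-homo-* a (D ℕ.* D)) (cong (⟦ a ⟧ *_) (⟦⟧-homo-* D D))
  regroup : ∀ x y z → x * ((y * z) * (y * z)) ≡ (z * z) * (x * (y * y))
  regroup = solve 3 (λ x y z → x :* ((y :* z) :* (y :* z)) := (z :* z) :* (x :* (y :* y))) refl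
  regroup′ : ∀ x y → (x * x) * (y * y) ≡ (x * y) * (x * y)
  regroup′ = solve 2 (λ x y → (x :* x) :* (y :* y) := (x :* y) :* (x :* y)) refl

expTerm-nonNeg : ∀ {q} → 0ℚ ≤ q → ∀ j → 0ℚ ≤ expTerm q j
expTerm-nonNeg 0≤q zero    = 0≤⟦⟧ 1
expTerm-nonNeg 0≤q (suc j) = 0≤* (0≤* (expTerm-nonNeg 0≤q j) 0≤q) (0≤1/[1+ j ])

expTerm≤expPartial : ∀ {q} → 0ℚ ≤ q → ∀ k → expTerm q k ≤ expPartial q k
expTerm≤expPartial 0≤q zero    = ≤-refl
expTerm≤expPartial {q} 0≤q (suc k) =
  subst (_≤ expPartial q (suc k)) (+-identityˡ (expTerm q (suc k)))
    (+-monoˡ-≤ (expTerm q (suc k)) (≤-trans (expTerm-nonNeg 0≤q k) (expTerm≤expPartial 0≤q k)))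

-- If a K ≤ q then each factor q/(j+1), j < K, of q^K/K! is at least a.
^≤expTerm : ∀ a K {q} → ⟦ a ℕ.* K ⟧ ≤ q → ∀ j → j ℕ.≤ K → ⟦ a ℕ.^ j ⟧ ≤ expTerm q j
^≤expTerm a K {q} aK≤q zero    _    = ≤-refl
^≤expTerm a K {q} aK≤q (suc j) j<K = begin
  ⟦ a ℕ.* a ℕ.^ j ⟧            ≡⟨ trans (⟦⟧-homo-* a (a ℕ.^ j)) (*-comm ⟦ a ⟧ ⟦ a ℕ.^ j ⟧) ⟩
  ⟦ a ℕ.^ j ⟧ * ⟦ a ⟧          ≤⟨ *-monoˡ-≤-nonNeg ⟦ a ℕ.^ j ⟧ {{ℚ.nonNegative (0≤⟦⟧ (a ℕ.^ j))}} a≤q/[1+j] ⟩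
  ⟦ a ℕ.^ j ⟧ * (q * r)        ≡⟨ sym (*-assoc ⟦ a ℕ.^ j ⟧ q r) ⟩
  ⟦ a ℕ.^ j ⟧ * q * r          ≤⟨ *-monoʳ-≤-nonNeg r {{ℚ.nonNegative (0≤1/[1+ j ])}}
                                    (*-monoʳ-≤-nonNeg q {{ℚ.nonNegative 0≤q}}
                                      (^≤expTerm a K aK≤q j (ℕP.<⇒≤ j<K))) ⟩
  expTerm q j * q * r          ∎
  where
  open ≤-Reasoning
  r : ℚ
  r = 1/[1+ j ]
  0≤q : 0ℚ ≤ q
  0≤q = ≤-trans (0≤⟦⟧ (a ℕ.* K)) aK≤q
  a≤q/[1+j] : ⟦ a ⟧ ≤ q * r
  a≤q/[1+j] = begin
    ⟦ a ⟧                        ≡⟨ sym (*-identityʳ ⟦ a ⟧) ⟩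
    ⟦ a ⟧ * 1ℚ                   ≡⟨ cong (⟦ a ⟧ *_) (sym (⟦1+⟧*1/[1+]≡1 j)) ⟩
    ⟦ a ⟧ * (⟦ suc j ⟧ * r)      ≡⟨ sym (*-assoc ⟦ a ⟧ ⟦ suc j ⟧ r) ⟩
    ⟦ a ⟧ * ⟦ suc j ⟧ * r        ≡⟨ cong (_* r) (sym (⟦⟧-homo-* a (suc j))) ⟩
    ⟦ a ℕ.* suc j ⟧ * r          ≤⟨ *-monoʳ-≤-nonNeg r {{ℚ.nonNegative (0≤1/[1+ j ])}}
                                      (≤-trans (⟦⟧-mono-≤ (ℕP.*-monoʳ-≤ a j<K)) aK≤q) ⟩
    q * r                        ∎

¬ExpLe-^ : ∀ {q} a K .{{_ : ℕ.NonZero K}} → ⟦ suc a ℕ.* K ⟧ ≤ q → ¬ ExpLe q (a ℕ.^ K)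
¬ExpLe-^ {q} a K [1+a]K≤q expLe = ℕP.<⇒≱ (ℕP.^-monoˡ-< K (ℕP.n<1+n a)) [1+a]^K≤a^K
  where
  [1+a]^K≤a^K : suc a ℕ.^ K ℕ.≤ a ℕ.^ K
  [1+a]^K≤a^K = ⟦⟧-cancel-≤ (begin
    ⟦ suc a ℕ.^ K ⟧   ≤⟨ ^≤expTerm (suc a) K [1+a]K≤q K ℕP.≤-refl ⟩
    expTerm q K       ≤⟨ expTerm≤expPartial (≤-trans (0≤⟦⟧ (suc a ℕ.* K)) [1+a]K≤q) K ⟩
    expPartial q K    ≤⟨ expLe K ⟩
    ⟦ a ℕ.^ K ⟧       ∎)
    where open ≤-Reasoning

[1+t]48t⁴D²≤t⁶ : ∀ t D → suc (96 ℕ.* (D ℕ.* D)) ℕ.≤ t →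
  (suc t ℕ.* (3 ℕ.* (4 ℕ.* ((2 ℕ.* t ℕ.^ 2) ℕ.* (2 ℕ.* t ℕ.^ 2))))) ℕ.* (D ℕ.* D)
    ℕ.≤ (t ℕ.^ 2 ℕ.* t) ℕ.* (t ℕ.^ 2 ℕ.* t)
[1+t]48t⁴D²≤t⁶ t D 96D²<t = begin
  (suc t ℕ.* (3 ℕ.* (4 ℕ.* ((2 ℕ.* t ℕ.^ 2) ℕ.* (2 ℕ.* t ℕ.^ 2))))) ℕ.* (D ℕ.* D)
                                          ≡⟨ factor-t⁴ t (D ℕ.* D) ⟩
  (t ℕ.* t ℕ.* t ℕ.* t) ℕ.* (48 ℕ.* suc t ℕ.* (D ℕ.* D))
                                          ≤⟨ ℕP.*-monoʳ-≤ (t ℕ.* t ℕ.* t ℕ.* t) 48[1+t]D²≤t² ⟩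
  (t ℕ.* t ℕ.* t ℕ.* t) ℕ.* (t ℕ.* t)    ≡⟨ t⁶ t ⟩
  (t ℕ.^ 2 ℕ.* t) ℕ.* (t ℕ.^ 2 ℕ.* t)    ∎
  where
  open ℕP.≤-Reasoning
  factor-t⁴ : ∀ x y →
    ((1 ℕ.+ x) ℕ.* (3 ℕ.* (4 ℕ.* ((2 ℕ.* (x ℕ.* (x ℕ.* 1))) ℕ.* (2 ℕ.* (x ℕ.* (x ℕ.* 1))))))) ℕ.* y
      ≡ (x ℕ.* x ℕ.* x ℕ.* x) ℕ.* (48 ℕ.* (1 ℕ.+ x) ℕ.* y)
  factor-t⁴ = solve-∀
  t⁶ : ∀ x → (x ℕ.* x ℕ.* x ℕ.* x) ℕ.* (x ℕ.* x) ≡ (x ℕ.* (x ℕ.* 1) ℕ.* x) ℕ.* (x ℕ.* (x ℕ.* 1) ℕ.* x)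
  t⁶ = solve-∀
  double : ∀ x y → 48 ℕ.* (x ℕ.+ x) ℕ.* y ≡ x ℕ.* (96 ℕ.* y)
  double = solve-∀
  48[1+t]D²≤t² : 48 ℕ.* suc t ℕ.* (D ℕ.* D) ℕ.≤ t ℕ.* t
  48[1+t]D²≤t² = begin
    48 ℕ.* suc t ℕ.* (D ℕ.* D)     ≤⟨ ℕP.*-monoˡ-≤ (D ℕ.* D) (ℕP.*-monoʳ-≤ 48
                                        (ℕP.+-monoˡ-≤ t (ℕP.≤-trans (ℕ.s≤s ℕ.z≤n) 96D²<t))) ⟩
    48 ℕ.* (t ℕ.+ t) ℕ.* (D ℕ.* D) ≡⟨ double t (D ℕ.* D) ⟩
    t ℕ.* (96 ℕ.* (D ℕ.* D))       ≤⟨ ℕP.*-monoʳ-≤ t (ℕP.<⇒≤ 96D²<t) ⟩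
    t ℕ.* t                        ∎

κt²<c⇒¬ExpLe : ∀ {κ} d t′ → let t = suc t′ in
  1/[1+ d ] ≤ κ → suc (96 ℕ.* (suc d ℕ.* suc d)) ℕ.≤ t → ∀ c → κ * ⟦ t ℕ.^ 2 ⟧ < c →
  ¬ ExpLe ((c * ⟦ t ⟧) * (c * ⟦ t ⟧)) ((t ℕ.^ 3) ℕ.^ (4 ℕ.* ((2 ℕ.* t ℕ.^ 2) ℕ.* (2 ℕ.* t ℕ.^ 2))))
κt²<c⇒¬ExpLe d t′ 1/D≤κ t₀≤t c κt²<c expLe =
  ¬ExpLe-^ t K [1+t]K≤[ct]² (subst (ExpLe q) (ℕP.^-*-assoc t 3 (4 ℕ.* (u ℕ.* u))) expLe)
  where
  open ≤-Reasoning
  t u K t³ : ℕ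
  t = suc t′
  u = 2 ℕ.* t ℕ.^ 2
  K = 3 ℕ.* (4 ℕ.* (u ℕ.* u))
  t³ = t ℕ.^ 2 ℕ.* t
  r q : ℚ
  r = 1/[1+ d ]
  q = (c * ⟦ t ⟧) * (c * ⟦ t ⟧)
  rt³≤ct : r * ⟦ t³ ⟧ ≤ c * ⟦ t ⟧
  rt³≤ct = begin
    r * ⟦ t³ ⟧                    ≡⟨ cong (r *_) (⟦⟧-homo-* (t ℕ.^ 2) t) ⟩
    r * (⟦ t ℕ.^ 2 ⟧ * ⟦ t ⟧)     ≡⟨ sym (*-assoc r ⟦ t ℕ.^ 2 ⟧ ⟦ t ⟧) ⟩
    r * ⟦ t ℕ.^ 2 ⟧ * ⟦ t ⟧       ≤⟨ *-monoʳ-≤-nonNeg ⟦ t ⟧ {{ℚ.nonNegative (0≤⟦⟧ t)}}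
                                     (≤-trans (*-monoʳ-≤-nonNeg ⟦ t ℕ.^ 2 ⟧ {{ℚ.nonNegative (0≤⟦⟧ (t ℕ.^ 2))}} 1/D≤κ)
                                              (<⇒≤ κt²<c)) ⟩
    c * ⟦ t ⟧                     ∎
  0≤rt³ : 0ℚ ≤ r * ⟦ t³ ⟧
  0≤rt³ = 0≤* (0≤1/[1+ d ]) (0≤⟦⟧ t³)
  [1+t]K≤[ct]² : ⟦ suc t ℕ.* K ⟧ ≤ q
  [1+t]K≤[ct]² = ≤-trans (⟦⟧≤square-div (suc t ℕ.* K) t³ d ([1+t]48t⁴D²≤t⁶ t (suc d) t₀≤t))
                         (*-mono-≤-nonNeg 0≤rt³ 0≤rt³ rt³≤ct rt³≤ct)

ExpLe⇒≤ : ∀ {κ} d t → 1/[1+ d ] ≤ κ → suc (96 ℕ.* (suc d ℕ.* suc d)) ℕ.≤ t → ∀ c →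
  ExpLe ((c * ⟦ t ⟧) * (c * ⟦ t ⟧)) ((t ℕ.^ 3) ℕ.^ (4 ℕ.* ((2 ℕ.* t ℕ.^ 2) ℕ.* (2 ℕ.* t ℕ.^ 2)))) →
  c ≤ κ * ⟦ t ℕ.^ 2 ⟧
ExpLe⇒≤ {κ} d t 1/D≤κ t₀≤t c expLe with c ≤? κ * ⟦ t ℕ.^ 2 ⟧
ExpLe⇒≤ d t       _     _    c _     | yes c≤κt² = c≤κt²
ExpLe⇒≤ d (suc t′) 1/D≤κ t₀≤t c expLe | no  c≰κt² =
  ⊥-elim (κt²<c⇒¬ExpLe d t′ 1/D≤κ t₀≤t c (≰⇒> c≰κt²) expLe)

GoodBound⇒≤ : ∀ {δ κ} d t w → 1/[1+ d ] ≤ κ → suc (96 ℕ.* (suc d ℕ.* suc d)) ℕ.≤ t →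
  GoodBound δ t w (2 ℕ.* t ℕ.^ 2) → (½ - δ) * ⟦ 2 ℕ.* t ℕ.^ 2 ⟧ - ⟦ w ⟧ ≤ κ * ⟦ t ℕ.^ 2 ⟧
GoodBound⇒≤ d t w 1/D≤κ t₀≤t (inj₁ c≤0) =
  ≤-trans c≤0 (0≤* (≤-trans (0≤1/[1+ d ]) 1/D≤κ) (0≤⟦⟧ (t ℕ.^ 2)))
GoodBound⇒≤ d t w 1/D≤κ t₀≤t (inj₂ expLe) = ExpLe⇒≤ d t 1/D≤κ t₀≤t _ expLe

sumF-+ : ∀ {n} (f g : Fin n → ℕ) → sumF (λ v → f v ℕ.+ g v) ≡ sumF f ℕ.+ sumF g
sumF-+ {zero}  f g = refl
sumF-+ {suc n} f g rewrite sumF-+ (λ i → f (suc i)) (λ i → g (suc i)) =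
  interchange (f zero) (g zero) (sumF (λ i → f (suc i))) (sumF (λ i → g (suc i)))
  where
  interchange : ∀ a b x y → (a ℕ.+ b) ℕ.+ (x ℕ.+ y) ≡ (a ℕ.+ x) ℕ.+ (b ℕ.+ y)
  interchange = solve-∀

sumF-cong : ∀ {n} {f g : Fin n → ℕ} → (∀ v → f v ≡ g v) → sumF f ≡ sumF g
sumF-cong {zero}  f≗g = refl
sumF-cong {suc n} f≗g = cong₂ ℕ._+_ (f≗g zero) (sumF-cong (λ i → f≗g (suc i)))

b2n-∧-partition : ∀ a b c → (T b → T a) → (T c → T a) → (T a → T b ⊎ T c) → (T b → ¬ T c) →
  ∀ x → b2n (a ∧ x) ≡ b2n (b ∧ x) ℕ.+ b2n (c ∧ x)
b2n-∧-partition false true  _     b⊆a _   _     _  _ = ⊥-elim (b⊆a _)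
b2n-∧-partition false false true  _   c⊆a _     _  _ = ⊥-elim (c⊆a _)
b2n-∧-partition false false false _   _   _     _  _ = refl
b2n-∧-partition true  true  true  _   _   _     b∩c _ = ⊥-elim (b∩c _ _)
b2n-∧-partition true  true  false _   _   _     _  _ = sym (ℕP.+-identityʳ _)
b2n-∧-partition true  false true  _   _   _     _  _ = refl
b2n-∧-partition true  false false _   _   a⊆b∪c _  _ with a⊆b∪c _
... | inj₁ ()
... | inj₂ ()

rowWeight-partition : ∀ {n m} (M : Fin m → Fin n → Bool) i {V V₁ V₂ : Set' n} → Partition₂ V V₁ V₂ →
  rowWeight M i V ≡ rowWeight M i V₁ ℕ.+ rowWeight M i V₂
rowWeight-partition M i {V} {V₁} {V₂} (disjoint , covers , V₁⊆V , V₂⊆V) =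
  trans (sumF-cong (λ v → b2n-∧-partition (V v) (V₁ v) (V₂ v) (V₁⊆V v) (V₂⊆V v) (covers v) (disjoint v) (M i v)))
        (sumF-+ (λ v → b2n (V₁ v ∧ M i v)) (λ v → b2n (V₂ v ∧ M i v)))

weight-on-complement : ∀ δ κ T a b →
  (½ - δ) * (⟦ 2 ⟧ * T) - (a + b) ≤ κ * T → a ≤ κ * T →
  (1ℚ - ⟦ 2 ⟧ * δ - ⟦ 2 ⟧ * κ) * T ≤ b
weight-on-complement δ κ T a b deficit≤κT a≤κT = begin
  (1ℚ - ⟦ 2 ⟧ * δ - ⟦ 2 ⟧ * κ) * T
    ≡⟨ rearrange δ κ T a b ⟩
  ((½ - δ) * (⟦ 2 ⟧ * T) - (a + b) - κ * T) + (a - κ * T) + b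
    ≤⟨ +-monoˡ-≤ b (+-mono-≤ (p≤q⇒p-q≤0 deficit≤κT) (p≤q⇒p-q≤0 a≤κT)) ⟩
  0ℚ + 0ℚ + b
    ≡⟨ +-identityˡ b ⟩
  b ∎
  where
  open ≤-Reasoning
  open +-*-Solver using (solve; _:=_; _:*_; _:+_; _:-_; con)
  rearrange : ∀ δ κ T a b → (1ℚ - ⟦ 2 ⟧ * δ - ⟦ 2 ⟧ * κ) * T
    ≡ ((½ - δ) * (⟦ 2 ⟧ * T) - (a + b) - κ * T) + (a - κ * T) + b
  rearrange = solve 5 (λ δ κ T a b →
      (con 1ℚ :- con ⟦ 2 ⟧ :* δ :- con ⟦ 2 ⟧ :* κ) :* T
    := ((con ½ :- δ) :* (con ⟦ 2 ⟧ :* T) :- (a :+ b) :- κ :* T) :+ (a :- κ :* T) :+ b) refl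

δ-good-row⇒weight-on-V₂ : ∀ {δ κ} d t {m n} (M : Fin m → Fin n → Bool) i {V V₁ V₂ : Set' n} →
  1/[1+ d ] ≤ κ → suc (96 ℕ.* (suc d ℕ.* suc d)) ℕ.≤ t → Partition₂ V V₁ V₂ →
  GoodBound δ t (rowWeight M i V) (2 ℕ.* t ℕ.^ 2) →
  ⟦ rowWeight M i V₁ ⟧ ≤ κ * ⟦ t ℕ.^ 2 ⟧ →
  (1ℚ - ⟦ 2 ⟧ * δ - ⟦ 2 ⟧ * κ) * ⟦ t ℕ.^ 2 ⟧ ≤ ⟦ rowWeight M i V₂ ⟧
δ-good-row⇒weight-on-V₂ {δ} {κ} d t M i {V} {V₁} {V₂} 1/D≤κ t₀≤t V₁⊎V₂ goodRow V₁-sparse =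
  weight-on-complement δ κ ⟦ t ℕ.^ 2 ⟧ ⟦ w₁ ⟧ ⟦ w₂ ⟧ deficit≤κt² V₁-sparse
  where
  w₁ w₂ : ℕ
  w₁ = rowWeight M i V₁
  w₂ = rowWeight M i V₂
  deficit≤κt² : (½ - δ) * (⟦ 2 ⟧ * ⟦ t ℕ.^ 2 ⟧) - (⟦ w₁ ⟧ + ⟦ w₂ ⟧) ≤ κ * ⟦ t ℕ.^ 2 ⟧
  deficit≤κt² = subst₂ (λ x y → (½ - δ) * x - y ≤ κ * ⟦ t ℕ.^ 2 ⟧)
    (⟦⟧-homo-* 2 (t ℕ.^ 2))
    (trans (cong ⟦_⟧ (rowWeight-partition M i V₁⊎V₂)) (⟦⟧-homo-+ w₁ w₂))
    (GoodBound⇒≤ {δ} {κ} d t (rowWeight M i V) 1/D≤κ t₀≤t goodRow)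

lemma20 : (κ δ η : ℚ) → 0ℚ < κ → κ < 1ℚ → 0ℚ < δ → 0ℚ < η → κ + δ ≤ ½ →
    ∃ λ t₀ → ∀ (t : ℕ) → t₀ ℕ.≤ t →
    (G : Graph (t ℕ.^ 3)) → IsTemplate κ t G →
    (A : Fin (t ℕ.^ 3) → Fin (t ℕ.^ 3) → Bool) → IsOrientation G A →
    (m : ℕ) (W : Fin m → Set' (t ℕ.^ 3)) (R : Set' (t ℕ.^ 3)) →
    IsWeakTiling η t A m W R →
    (V : Set' (t ℕ.^ 3)) → ∣ V ∣ ≡ 2 ℕ.* t ℕ.^ 2 →
    IsGood δ t (freeMatrix A W) V →
    (V₁ V₂ : Set' (t ℕ.^ 3)) → Partition₂ V V₁ V₂ →
    ∣ V₁ ∣ ≡ t ℕ.^ 2 → ∣ V₂ ∣ ≡ t ℕ.^ 2 →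
    (𝒲₁ 𝒲₂ : Set' m) → Partition₂ (λ _ → true) 𝒲₁ 𝒲₂ →
    (½ - δ - κ) * ⟦ t ⟧ - ⟦ 2 ⟧ ≤ ⟦ ∣ 𝒲₁ ∣ ⟧ →
    ⟦ ∣ 𝒲₂ ∣ ⟧ < (½ + δ + κ) * ⟦ t ⟧ →
    (∀ i → i ∈ 𝒲₁ → ⟦ rowWeight (freeMatrix A W) i V₁ ⟧ ≤ κ * ⟦ t ℕ.^ 2 ⟧) →
    (∀ i → i ∈ 𝒲₂ → κ * ⟦ t ℕ.^ 2 ⟧ ≤ ⟦ rowWeight (freeMatrix A W) i V₁ ⟧) →
    ∀ i → i ∈ 𝒲₁ →
      (1ℚ - ⟦ 2 ⟧ * δ - ⟦ 2 ⟧ * κ) * ⟦ t ℕ.^ 2 ⟧ ≤ ⟦ rowWeight (freeMatrix A W) i V₂ ⟧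
lemma20 κ δ _ 0<κ _ _ _ _ with ∃1/[1+]≤ 0<κ
... | d , 1/D≤κ = suc (96 ℕ.* (suc d ℕ.* suc d)) ,
  λ t t₀≤t _ _ A _ _ W _ _ V ∣V∣≡2t² good V₁ V₂ V₁⊎V₂ _ _ _ _ _ _ _ 𝒲₁-sparse _ i i∈𝒲₁ →
    δ-good-row⇒weight-on-V₂ {δ} {κ} d t (freeMatrix A W) i 1/D≤κ t₀≤t V₁⊎V₂
      (subst (GoodBound δ t (rowWeight (freeMatrix A W) i V)) ∣V∣≡2t² (good i))
      (𝒲₁-sparse i i∈𝒲₁)
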